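{- Let $r\ge 3$ and let $Q_r$ be the graph defined in the context, with meridian cycles $C_1,\dots,C_r$. Suppose that $1\le i<j\le r$ and let $t=j-i-1$. Let $S_i\subset C_i$ and $S_j\subseteq C_j$ be paths of length at least $2t-1$. Then $Q_r$ contains $t$ pairwise disjoint paths, each linking a vertex of $S_i$ with a vertex of $S_j$. Moreover, these paths can be chosen so that for each of them and for every $k$ with $i<k<j$, the intersection of the path with $C_k$ is a connected segment of $C_k$.
   Context: For an integer $r\ge 3$, $Q_r$ is the graph with vertex set $\{(i,j)\mid 1\le i\le r,\ 1\le j\le 2r\}$ in which $(i,j)$ and $(i',j')$ are adjacent if and only if either (1) $i'=i$ and $j'\in\{j-1,j+1\}$, with $j\pm1$ taken modulo $2r$; or (2) $j'=j$ and $i'=i+(-1)^{i+j}$. For $1\le i\le r$, the meridian cycle $C_i$ is the cycle of length $2r$ on the vertex set $\{(i,j)\mid 1\le j\le 2r\}$ formed by the edges of type (1). -}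

module Defs where

open import Data.Nat using (ℕ; zero; suc; _+_; _*_; _∸_; _≤_; _<_; _%_)
open import Data.Fin using (Fin; toℕ)
open import Data.Product using (Σ; _×_; _,_; proj₁; proj₂)
open import Data.Sum using (_⊎_)
open import Data.Empty using (⊥)
open import Data.List using (List; []; _∷_; length; lookup)
open import Data.List.Membership.Propositional using (_∈_)
open import Data.List.Relation.Unary.Linked using (Linked)
open import Data.List.Relation.Unary.Unique.Propositional using (Unique)
open import Data.List.Relation.Unary.All using (All)
open import Relation.Binary.PropositionalEquality using (_≡_)

-- Vertices of Q_r, 0-indexed: (i , j) with i < r (row), j < 2r (column).
-- The paper's vertex (i+1, j+1) corresponds to (i , j); parity of i+j is unchanged.
Vertex : ℕ → Set
Vertex r = Fin r × Fin (2 * r)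

-- Adjacency in Q_r.
-- (1) same row, columns differ by ±1 modulo 2r;
-- (2) same column, i' = i + (-1)^(i+j)  (i.e. i' = i+1 if i+j even, i' = i-1 if odd).
CycSucc : (r : ℕ) → Fin (2 * r) → Fin (2 * r) → Set
CycSucc r b b' = (toℕ b' ≡ suc (toℕ b)) ⊎ ((suc (toℕ b) ≡ 2 * r) × (toℕ b' ≡ 0))

Adj : (r : ℕ) → Vertex r → Vertex r → Set
Adj r (a , b) (a' , b') =
  (a ≡ a' × (CycSucc r b b' ⊎ CycSucc r b' b))
  ⊎ (b ≡ b' × (((toℕ a + toℕ b) % 2 ≡ 0 × toℕ a' ≡ suc (toℕ a))
             ⊎ ((toℕ a + toℕ b) % 2 ≡ 1 × suc (toℕ a') ≡ toℕ a)))

IsPath : (r : ℕ) → List (Vertex r) → Set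
IsPath r p = (0 < length p) × Unique p × Linked (Adj r) p

edgeLength : {A : Set} → List A → ℕ
edgeLength p = length p ∸ 1

-- Vertex lies on the meridian cycle C_k.
InRow : {r : ℕ} → Fin r → Vertex r → Set
InRow k v = proj₁ v ≡ k

lastOr : {A : Set} → A → List A → A
lastOr x [] = x
lastOr x (y ∷ ys) = lastOr y ys

Ends : {A : Set} → List A → A → A → Set
Ends {A} p u v = Σ (List A) λ xs → (p ≡ u ∷ xs) × (lastOr u xs ≡ v)

Links : {A : Set} → List A → List A → List A → Set
Links {A} p S T = Σ A λ u → Σ A λ v → (u ∈ S) × (v ∈ T) × Ends p u v

-- The vertices of the path p lying on C_k occur consecutively along p,
-- i.e. the intersection of p with C_k is a connected segment of C_k (or empty).
SegmentOn : {r : ℕ} → Fin r → List (Vertex r) → Set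
SegmentOn k p = (a b c : Fin (length p)) → toℕ a ≤ toℕ b → toℕ b ≤ toℕ c →
  InRow k (lookup p a) → InRow k (lookup p c) → InRow k (lookup p b)

Disjoint : {A : Set} → List A → List A → Set
Disjoint {A} p q = (v : A) → v ∈ p → v ∈ q → ⊥

-- A path of length at least 2t - 1 on a meridian runs through consecutive columns, so it contains
-- t vertices in columns c, c + 2, ..., c + 2(t - 1), with c of any prescribed parity.  Path s
-- starts in column c + 2s of C_i and climbs as a staircase: in row i + m it walks horizontally to a
-- column from which the vertical edge leads up, and climbs.  All paths follow one column schedule
-- shifted by 2s, so in each row they occupy disjoint column intervals, also modulo N = 2r, and
-- rows never decrease along a staircase, which gives the segment property.  The schedule has to
-- realise, modulo N, the offset D between the chosen columns on S_i and on S_j, and the parities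
-- make D + t even.  If D < t or D + t > N it walks right for p rows and then left, with 2p = D + t
-- or D + t - N; otherwise it moves one column per row and path s jumps D - t further columns in
-- row i + t - s, which keeps the paths ordered.
module Submission where

open import Defs
open import Data.Nat using (ℕ; zero; suc; _+_; _*_; _∸_; _≤_; _<_; _%_; _/_; z≤n; s≤s; NonZero; pred; _≤?_; _<?_; _⊓_)
open import Data.Nat.Properties
open import Data.Nat.DivMod using (_mod_; m≡m%n+[m/n]*n; m%n<n; m<n⇒m%n≡m; [m+kn]%n≡m%n; [m+n]%n≡m%n; n%n≡0; %-distribˡ-+; m%n%n≡m%n; m≤n⇒[n∸m]%m≡n%m)
open import Data.Nat.Divisibility using (_∣_; divides; ∣m+n∣m⇒∣n; ∣m∣n⇒∣m+n; n∣m⇒m%n≡0; m∣m*n; ∣n⇒∣m*n)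
open import Data.Fin as Fin using (Fin; toℕ)
open import Data.Fin.Properties using (toℕ-injective; toℕ-fromℕ<; toℕ<n)
open import Data.Product using (Σ; _×_; _,_; proj₁; proj₂)
open import Data.Sum using (_⊎_; inj₁; inj₂)
open import Data.Empty using (⊥; ⊥-elim)
open import Data.Unit using (⊤; tt)
open import Relation.Binary.PropositionalEquality
open import Relation.Binary.Definitions using (tri<; tri≈; tri>)
open import Relation.Nullary using (Dec; yes; no; ¬_)
open import Function using (_∘_)
open import Data.List using (List; []; _∷_; length; lookup)
open import Data.List.Membership.Propositional using (_∈_; _∉_)
open import Data.List.Relation.Unary.Any using (here; there)
open import Data.List.Relation.Unary.All as All using (All; []; _∷_)
open import Data.List.Relation.Unary.All.Properties using (¬Any⇒All¬)
open import Data.List.Relation.Unary.AllPairs using ([]; _∷_)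
open import Data.List.Relation.Unary.Linked as Linked using (Linked; []; [-]; _∷_)
open import Data.List.Relation.Unary.Linked.Properties using (Linked⇒All)
open import Data.List.Relation.Unary.Unique.Propositional using (Unique)
open import Data.Maybe.Relation.Binary.Connected using (just)
open import Data.Nat.Tactic.RingSolver using (solve-∀)

m≤suc[pred[m]] : ∀ m → m ≤ suc (pred m)
m≤suc[pred[m]] zero = z≤n
m≤suc[pred[m]] (suc m) = ≤-refl

m∸n≡1+m∸[1+n] : ∀ m n → n < m → m ∸ n ≡ suc (m ∸ suc n)
m∸n≡1+m∸[1+n] (suc m) zero _ = refl
m∸n≡1+m∸[1+n] (suc m) (suc n) (s≤s n<m) = m∸n≡1+m∸[1+n] m n n<m

m<n⇒n≡m+[1+n∸m∸1] : ∀ {m n} → m < n → n ≡ m + suc (n ∸ m ∸ 1)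
m<n⇒n≡m+[1+n∸m∸1] {m} {n} m<n = sym (begin
  m + suc (n ∸ m ∸ 1)    ≡⟨ cong (m +_) (trans (+-comm 1 (n ∸ m ∸ 1)) (m∸n+n≡m (m<n⇒0<n∸m m<n))) ⟩
  m + (n ∸ m)            ≡⟨ m+[n∸m]≡n (<⇒≤ m<n) ⟩
  n                      ∎)
  where open ≡-Reasoning

n<o⇒2+[m+2*n]≤m+2*o : ∀ m {n o} → n < o → suc (suc (m + 2 * n)) ≤ m + 2 * o
n<o⇒2+[m+2*n]≤m+2*o m {n} {o} n<o = subst (_≤ m + 2 * o) (regroup m n) (+-monoʳ-≤ m (*-monoʳ-≤ 2 n<o))
  where
    regroup : ∀ m n → m + 2 * suc n ≡ suc (suc (m + 2 * n))
    regroup = solve-∀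

even-or-odd : ∀ n → 2 ∣ n ⊎ 2 ∣ suc n
even-or-odd zero = inj₁ (divides 0 refl)
even-or-odd (suc n) with even-or-odd n
... | inj₁ (divides q n≡2q) = inj₂ (divides (suc q) (cong (2 +_) n≡2q))
... | inj₂ 2∣1+n = inj₁ 2∣1+n

parity-offset : ∀ p a → Σ ℕ λ o → o ≤ 1 × 2 ∣ p + (a + o)
parity-offset p a with even-or-odd (p + a)
... | inj₁ 2∣p+a = 0 , z≤n , subst (2 ∣_) (cong (p +_) (sym (+-identityʳ a))) 2∣p+a
... | inj₂ 2∣1+p+a = 1 , s≤s z≤n , subst (2 ∣_) (trans (sym (+-suc p a)) (cong (p +_) (+-comm 1 a))) 2∣1+p+a

Between : ℕ → ℕ → ℕ → Set
Between x a b = (a ≤ x × x ≤ b) ⊎ (b ≤ x × x ≤ a)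

Between-left : ∀ a b → Between a a b
Between-left a b with a ≤? b
... | yes a≤b = inj₁ (≤-refl , a≤b)
... | no a≰b = inj₂ (≰⇒≥ a≰b , ≤-refl)

Between-bounds : ∀ {x a b lo hi} → lo ≤ a → lo ≤ b → a ≤ hi → b ≤ hi → Between x a b → lo ≤ x × x ≤ hi
Between-bounds lo≤a _ _ b≤hi (inj₁ (a≤x , x≤b)) = ≤-trans lo≤a a≤x , ≤-trans x≤b b≤hi
Between-bounds _ lo≤b a≤hi _ (inj₂ (b≤x , x≤a)) = ≤-trans lo≤b b≤x , ≤-trans x≤a a≤hi

Adjacent : ℕ → ℕ → Set
Adjacent a b = a ≤ suc b × b ≤ suc a

Adjacent-refl : ∀ a → Adjacent a a
Adjacent-refl a = n≤1+n a , n≤1+n a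

Adjacent-suc : ∀ a → Adjacent a (suc a)
Adjacent-suc a = ≤-trans (n≤1+n a) (n≤1+n (suc a)) , ≤-refl

Adjacent-sym : ∀ {a b} → Adjacent a b → Adjacent b a
Adjacent-sym (a≤1+b , b≤1+a) = b≤1+a , a≤1+b

Adjacent-+ʳ : ∀ {a b} d → Adjacent a b → Adjacent (a + d) (b + d)
Adjacent-+ʳ d (a≤1+b , b≤1+a) = +-monoˡ-≤ d a≤1+b , +-monoˡ-≤ d b≤1+a

Adjacent-∸ : ∀ {a b} → Adjacent a b → b ∸ a ≤ 1 × a ∸ b ≤ 1
Adjacent-∸ {a} {b} (a≤1+b , b≤1+a) =
  m≤n+o⇒m∸n≤o b a (subst (b ≤_) (+-comm 1 a) b≤1+a) , m≤n+o⇒m∸n≤o a b (subst (a ≤_) (+-comm 1 b) a≤1+b)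

Adjacent-≤-suc-⊓ : ∀ {a b} → Adjacent a b → a ≤ suc (a ⊓ b) × b ≤ suc (a ⊓ b)
Adjacent-≤-suc-⊓ {a} {b} (a≤1+b , b≤1+a) with ⊓-sel a b
... | inj₁ a⊓b≡a = subst (λ z → a ≤ suc z) (sym a⊓b≡a) (n≤1+n a) , subst (λ z → b ≤ suc z) (sym a⊓b≡a) b≤1+a
... | inj₂ a⊓b≡b = subst (λ z → a ≤ suc z) (sym a⊓b≡b) a≤1+b , subst (λ z → b ≤ suc z) (sym a⊓b≡b) (n≤1+n b)

Between-⊓ : ∀ {a b} d {x} → Adjacent a b → Between x (a + d) (b + d) → a ⊓ b + d ≤ x × x ≤ suc (a ⊓ b + d)
Between-⊓ {a} {b} d adj = Between-bounds (+-monoˡ-≤ d (m⊓n≤m a b)) (+-monoˡ-≤ d (m⊓n≤n a b))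
  (+-monoˡ-≤ d (proj₁ (Adjacent-≤-suc-⊓ adj))) (+-monoˡ-≤ d (proj₂ (Adjacent-≤-suc-⊓ adj)))

lookup-mono : ∀ {A : Set} (f : A → ℕ) {xs : List A} → Linked (λ a b → f a ≤ f b) xs →
  (a b : Fin (length xs)) → toℕ a ≤ toℕ b → f (lookup xs a) ≤ f (lookup xs b)
lookup-mono f {x ∷ xs} L Fin.zero b _ = Linked.lookup ≤-trans L (just ≤-refl) b
lookup-mono f {x ∷ y ∷ ys} (_ ∷ L) (Fin.suc a) (Fin.suc b) (s≤s a≤b) = lookup-mono f L a b a≤b

module Congruence (N : ℕ) .{{_ : NonZero N}} where

  infix 4 _≋_
  _≋_ : ℕ → ℕ → Set
  x ≋ y = x % N ≡ y % N

  ≋-+ʳ : ∀ {x y} z → x ≋ y → x + z ≋ y + z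
  ≋-+ʳ {x} {y} z x≋y = begin
    (x + z) % N           ≡⟨ %-distribˡ-+ x z N ⟩
    (x % N + z % N) % N   ≡⟨ cong (λ u → (u + z % N) % N) x≋y ⟩
    (y % N + z % N) % N   ≡⟨ %-distribˡ-+ y z N ⟨
    (y + z) % N           ∎
    where open ≡-Reasoning

  %-≋ : ∀ x → x % N ≋ x
  %-≋ x = m%n%n≡m%n x N

  +N-≋ : ∀ x → x + N ≋ x
  +N-≋ x = [m+n]%n≡m%n x N

  %-+-small : ∀ a {d} → d < N → (a + d) % N ≡ (a % N + d) % N
  %-+-small a {d} d<N = trans (%-distribˡ-+ a d N) (cong (λ z → (a % N + z) % N) (m<n⇒m%n≡m d<N))

  +-≋-self : ∀ a {d} → 0 < d → d < N → ¬ (a + d ≋ a)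
  +-≋-self a {d} 0<d d<N a+d≋a with a % N + d <? N
  ... | yes small = <⇒≢ 0<d (sym (+-cancelˡ-≡ (a % N) d 0 (begin
        a % N + d         ≡⟨ m<n⇒m%n≡m small ⟨
        (a % N + d) % N   ≡⟨ %-+-small a d<N ⟨
        (a + d) % N       ≡⟨ a+d≋a ⟩
        a % N             ≡⟨ +-identityʳ (a % N) ⟨
        a % N + 0         ∎)))
    where open ≡-Reasoning
  ... | no large = <⇒≢ d<N (+-cancelˡ-≡ (a % N) d N (begin
        a % N + d                 ≡⟨ m∸n+n≡m N≤ ⟨
        (a % N + d ∸ N) + N       ≡⟨ cong (_+ N) wrapped ⟩
        a % N + N                 ∎))
    where
      open ≡-Reasoning
      N≤ : N ≤ a % N + d
      N≤ = ≮⇒≥ large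
      wrapped : a % N + d ∸ N ≡ a % N
      wrapped = begin
        a % N + d ∸ N             ≡⟨ m<n⇒m%n≡m (+-cancelʳ-< N _ N (subst (_< N + N) (sym (m∸n+n≡m N≤)) (+-mono-< (m%n<n a N) d<N))) ⟨
        (a % N + d ∸ N) % N       ≡⟨ m≤n⇒[n∸m]%m≡n%m N≤ ⟩
        (a % N + d) % N           ≡⟨ %-+-small a d<N ⟨
        (a + d) % N               ≡⟨ a+d≋a ⟩
        a % N                     ∎

  ≋-window : ∀ {x y} → x < y → y < x + N → ¬ (x ≋ y)
  ≋-window {x} {y} x<y y<x+N x≋y =
    +-≋-self x (m<n⇒0<n∸m x<y) (+-cancelˡ-< x _ N (subst (_< x + N) (sym x+d≡y) y<x+N)) (trans (cong (_% N) x+d≡y) (sym x≋y))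
    where
      x+d≡y : x + (y ∸ x) ≡ y
      x+d≡y = m+[n∸m]≡n (<⇒≤ x<y)

  suc-% : ∀ x → suc x % N ≡ suc (x % N) % N
  suc-% x = trans (cong (λ z → suc z % N) (m≡m%n+[m/n]*n x N)) ([m+kn]%n≡m%n (suc (x % N)) (x / N) N)

  module _ {d : ℕ} (d∣N : d ∣ N) where

    ∣-+-% : ∀ k x → d ∣ k + x → d ∣ k + x % N
    ∣-+-% k x d∣k+x = ∣m+n∣m⇒∣n (subst (d ∣_) split d∣k+x) (∣n⇒∣m*n (x / N) d∣N)
      where
        split : k + x ≡ x / N * N + (k + x % N)
        split = trans (cong (k +_) (m≡m%n+[m/n]*n x N))
                      (trans (sym (+-assoc k (x % N) _)) (+-comm (k + x % N) _))

    ∣-+-%⁻ : ∀ k x → d ∣ k + x % N → d ∣ k + x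
    ∣-+-%⁻ k x d∣k+x% = subst (d ∣_) join (∣m∣n⇒∣m+n d∣k+x% (∣n⇒∣m*n (x / N) d∣N))
      where
        join : k + x % N + x / N * N ≡ k + x
        join = trans (+-assoc k (x % N) _) (cong (k +_) (sym (m≡m%n+[m/n]*n x N)))

    ∣-+-≋ : ∀ k {x y} → x ≋ y → d ∣ k + x → d ∣ k + y
    ∣-+-≋ k {x} {y} x≋y d∣k+x = ∣-+-%⁻ k y (subst (λ z → d ∣ k + z) x≋y (∣-+-% k x d∣k+x))

module Grid (r′ : ℕ) where

  r N : ℕ
  r = suc r′
  N = 2 * r

  open Congruence N public

  -- columns are read modulo N, so horizontal walks may wrap around the meridian
  vertex : ℕ → ℕ → Vertex r
  vertex k x = (k mod r , x mod N)

  row col : Vertex r → ℕ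
  row v = toℕ (proj₁ v)
  col v = toℕ (proj₂ v)

  col-vertex : ∀ k x → col (vertex k x) ≡ x % N
  col-vertex k x = toℕ-fromℕ< (m%n<n x N)

  row-vertex : ∀ {k} x → k < r → row (vertex k x) ≡ k
  row-vertex {k} x k<r = trans (toℕ-fromℕ< (m%n<n k r)) (m<n⇒m%n≡m k<r)

  vertex-cong : ∀ k {x y} → x ≋ y → vertex k x ≡ vertex k y
  vertex-cong k {x} {y} x≋y = cong (k mod r ,_) (toℕ-injective (trans (col-vertex k x) (trans x≋y (sym (col-vertex k y)))))

  vertex-col-≋ : ∀ {k l x y} → vertex k x ≡ vertex l y → x ≋ y
  vertex-col-≋ {k} {l} {x} {y} eq = trans (sym (col-vertex k x)) (trans (cong col eq) (col-vertex l y))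

  vertex-row-≡ : ∀ {k l x y} → k < r → l < r → vertex k x ≡ vertex l y → k ≡ l
  vertex-row-≡ {x = x} {y} k<r l<r eq = trans (sym (row-vertex x k<r)) (trans (cong row eq) (row-vertex y l<r))

  vertex-η : ∀ {k : Fin r} v x → proj₁ v ≡ k → col v ≡ x % N → vertex (toℕ k) x ≡ v
  vertex-η {k} (a , b) x refl b≡x = cong₂ _,_ (toℕ-injective (row-vertex x (toℕ<n k)))
                                              (toℕ-injective (trans (col-vertex (toℕ k) x) (sym b≡x)))

  cycSucc-mod : ∀ x → CycSucc r (x mod N) (suc x mod N)
  cycSucc-mod x with suc (x % N) <? N
  ... | yes small = inj₁ (begin
          col (vertex 0 (suc x))  ≡⟨ col-vertex 0 (suc x) ⟩
          suc x % N               ≡⟨ suc-% x ⟩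
          suc (x % N) % N         ≡⟨ m<n⇒m%n≡m small ⟩
          suc (x % N)             ≡⟨ cong suc (col-vertex 0 x) ⟨
          suc (col (vertex 0 x))  ∎)
    where open ≡-Reasoning
  ... | no large = inj₂ (trans (cong suc (col-vertex 0 x)) wraps ,
                         trans (col-vertex 0 (suc x)) (trans (suc-% x) (trans (cong (_% N) wraps) (n%n≡0 N))))
    where
      wraps : suc (x % N) ≡ N
      wraps = ≤-antisym (m%n<n x N) (≮⇒≥ large)

  cycSucc-col : ∀ {b b′} → CycSucc r b b′ → toℕ b′ ≡ suc (toℕ b) % N
  cycSucc-col {b} {b′} (inj₁ b′≡1+b) = trans b′≡1+b (sym (m<n⇒m%n≡m (subst (_< N) b′≡1+b (toℕ<n b′))))
  cycSucc-col (inj₂ (1+b≡N , b′≡0)) = trans b′≡0 (sym (trans (cong (_% N) 1+b≡N) (n%n≡0 N)))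

  adj-right : ∀ k x → Adj r (vertex k x) (vertex k (suc x))
  adj-right k x = inj₁ (refl , inj₁ (cycSucc-mod x))

  adj-left : ∀ k x → Adj r (vertex k (suc x)) (vertex k x)
  adj-left k x = inj₁ (refl , inj₂ (cycSucc-mod x))

  2∣N : 2 ∣ N
  2∣N = m∣m*n r

  adj-up : ∀ k x → suc k < r → 2 ∣ k + x → Adj r (vertex k x) (vertex (suc k) x)
  adj-up k x 1+k<r 2∣k+x = inj₂ (refl , inj₁ (even , trans (row-vertex x 1+k<r) (cong suc (sym (row-vertex x k<r)))))
    where
      k<r = <⇒≤ 1+k<r
      even : (row (vertex k x) + col (vertex k x)) % 2 ≡ 0
      even = subst (λ z → z % 2 ≡ 0) (sym (cong₂ _+_ (row-vertex x k<r) (col-vertex k x)))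
                   (n∣m⇒m%n≡0 _ 2 (∣-+-% 2∣N k x 2∣k+x))

  -- horizontal walks along row k list the vertices after the starting one, then tl; walkLeft starts in column n + b
  walkRight : ℕ → ℕ → ℕ → List (Vertex r) → List (Vertex r)
  walkRight k a zero tl = tl
  walkRight k a (suc n) tl = vertex k (suc a) ∷ walkRight k (suc a) n tl

  walkLeft : ℕ → ℕ → ℕ → List (Vertex r) → List (Vertex r)
  walkLeft k b zero tl = tl
  walkLeft k b (suc n) tl = vertex k (n + b) ∷ walkLeft k b n tl

  walk : ℕ → ℕ → ℕ → List (Vertex r) → List (Vertex r)
  walk k a b tl with a ≤? b
  ... | yes _ = walkRight k a (b ∸ a) tl
  ... | no _ = walkLeft k b (a ∸ b) tl

  climb : ℕ → (ℕ → ℕ) → ℕ → List (Vertex r)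
  climb k E zero = []
  climb k E (suc u) = walk k (E 0) (E 1) (vertex (suc k) (E 1) ∷ climb (suc k) (E ∘ suc) u)

  -- row k + m is traversed from column E m to column E (suc m), then the path climbs to row k + m + 1
  staircase : ℕ → (ℕ → ℕ) → ℕ → List (Vertex r)
  staircase k E u = vertex k (E 0) ∷ climb k E u

  module WalkLinked (R : Vertex r → Vertex r → Set)
    (R-right : ∀ k x → R (vertex k x) (vertex k (suc x)))
    (R-left : ∀ k x → R (vertex k (suc x)) (vertex k x)) where

    walkRight-linked : ∀ k a n {y ys} → R (vertex k (n + a)) y → Linked R (y ∷ ys) →
      Linked R (vertex k a ∷ walkRight k a n (y ∷ ys))
    walkRight-linked k a zero Ry L = Ry ∷ L
    walkRight-linked k a (suc n) {y} Ry L =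
      R-right k a ∷ walkRight-linked k (suc a) n (subst (λ z → R (vertex k z) y) (sym (+-suc n a)) Ry) L

    walkLeft-linked : ∀ k b n {y ys} → R (vertex k b) y → Linked R (y ∷ ys) →
      Linked R (vertex k (n + b) ∷ walkLeft k b n (y ∷ ys))
    walkLeft-linked k b zero Ry L = Ry ∷ L
    walkLeft-linked k b (suc n) Ry L = R-left k (n + b) ∷ walkLeft-linked k b n Ry L

    walk-linked : ∀ k a b {y ys} → R (vertex k b) y → Linked R (y ∷ ys) → Linked R (vertex k a ∷ walk k a b (y ∷ ys))
    walk-linked k a b {y} {ys} Ry L with a ≤? b
    ... | yes a≤b = walkRight-linked k a (b ∸ a) (subst (λ z → R (vertex k z) y) (sym (m∸n+n≡m a≤b)) Ry) L
    ... | no a≰b = subst (λ z → Linked R (vertex k z ∷ walkLeft k b (a ∸ b) (y ∷ ys))) (m∸n+n≡m (≰⇒≥ a≰b))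
                         (walkLeft-linked k b (a ∸ b) Ry L)

    staircase-linked : ∀ k E u → (∀ m → m < u → R (vertex (k + m) (E (suc m))) (vertex (suc (k + m)) (E (suc m)))) →
      Linked R (staircase k E u)
    staircase-linked k E zero R-up = [-]
    staircase-linked k E (suc u) R-up =
      walk-linked k (E 0) (E 1) (subst (λ z → R (vertex z (E 1)) (vertex (suc z) (E 1))) (+-identityʳ k) (R-up 0 (s≤s z≤n)))
        (staircase-linked (suc k) (E ∘ suc) u
          (λ m m<u → subst (λ z → R (vertex z (E (2 + m))) (vertex (suc z) (E (2 + m)))) (+-suc k m) (R-up (suc m) (s≤s m<u))))

  staircase-rows-linked : ∀ k E u → k + u < r → Linked (λ v w → row v ≤ row w) (staircase k E u)
  staircase-rows-linked k E u k+u<r = staircase-linked k E u row-up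
    where
      open WalkLinked (λ v w → row v ≤ row w) (λ _ _ → ≤-refl) (λ _ _ → ≤-refl)
      row-up : ∀ m → m < u → row (vertex (k + m) (E (suc m))) ≤ row (vertex (suc (k + m)) (E (suc m)))
      row-up m m<u = subst₂ _≤_ (sym (row-vertex (E (suc m)) (<⇒≤ 1+k+m<r))) (sym (row-vertex (E (suc m)) 1+k+m<r)) (n≤1+n (k + m))
        where
          1+k+m<r : suc (k + m) < r
          1+k+m<r = ≤-<-trans (subst (_≤ k + u) (+-suc k m) (+-monoʳ-≤ k m<u)) k+u<r

  staircase-segment : ∀ k E u → k + u < r → ∀ l → SegmentOn l (staircase k E u)
  staircase-segment k E u k+u<r l a b c a≤b b≤c a∈l c∈l = toℕ-injective (≤-antisym
    (subst (λ z → row (lookup p b) ≤ toℕ z) c∈l (lookup-mono row rows b c b≤c))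
    (subst (λ z → toℕ z ≤ row (lookup p b)) a∈l (lookup-mono row rows a b a≤b)))
    where
      p = staircase k E u
      rows = staircase-rows-linked k E u k+u<r

  staircase-rows-above : ∀ k E u → k + u < r → All (λ v → k ≤ row v) (staircase k E u)
  staircase-rows-above k E u k+u<r =
    All.map (λ {v} → subst (_≤ row v) (row-vertex (E 0) (≤-<-trans (m≤m+n k u) k+u<r)))
            (Linked⇒All ≤-trans {v = vertex k (E 0)} ≤-refl (staircase-rows-linked k E u k+u<r))

  ∈-walkRight : ∀ k a n {tl v} → v ∈ walkRight k a n tl → (Σ ℕ λ x → a < x × x ≤ n + a × v ≡ vertex k x) ⊎ v ∈ tl
  ∈-walkRight k a zero v∈ = inj₂ v∈
  ∈-walkRight k a (suc n) (here eq) = inj₁ (suc a , ≤-refl , s≤s (m≤n+m a n) , eq)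
  ∈-walkRight k a (suc n) (there v∈) with ∈-walkRight k (suc a) n v∈
  ... | inj₁ (x , 1+a<x , x≤ , eq) = inj₁ (x , <-trans (n<1+n a) 1+a<x , subst (x ≤_) (+-suc n a) x≤ , eq)
  ... | inj₂ v∈tl = inj₂ v∈tl

  ∈-walkLeft : ∀ k b n {tl v} → v ∈ walkLeft k b n tl → (Σ ℕ λ x → b ≤ x × x < n + b × v ≡ vertex k x) ⊎ v ∈ tl
  ∈-walkLeft k b zero v∈ = inj₂ v∈
  ∈-walkLeft k b (suc n) (here eq) = inj₁ (n + b , m≤n+m b n , n<1+n (n + b) , eq)
  ∈-walkLeft k b (suc n) (there v∈) with ∈-walkLeft k b n v∈
  ... | inj₁ (x , b≤x , x< , eq) = inj₁ (x , b≤x , m<n⇒m<1+n x< , eq)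
  ... | inj₂ v∈tl = inj₂ v∈tl

  ∈-walk : ∀ k a b {tl v} → v ∈ walk k a b tl → (Σ ℕ λ x → Between x a b × v ≡ vertex k x) ⊎ v ∈ tl
  ∈-walk k a b v∈ with a ≤? b
  ∈-walk k a b v∈ | yes a≤b with ∈-walkRight k a (b ∸ a) v∈
  ... | inj₁ (x , a<x , x≤ , eq) = inj₁ (x , inj₁ (<⇒≤ a<x , subst (x ≤_) (m∸n+n≡m a≤b) x≤) , eq)
  ... | inj₂ v∈tl = inj₂ v∈tl
  ∈-walk k a b v∈ | no a≰b with ∈-walkLeft k b (a ∸ b) v∈
  ... | inj₁ (x , b≤x , x< , eq) = inj₁ (x , inj₂ (b≤x , <⇒≤ (subst (x <_) (m∸n+n≡m (≰⇒≥ a≰b)) x<)) , eq)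
  ... | inj₂ v∈tl = inj₂ v∈tl

  ∈-staircase : ∀ k E u {v} → v ∈ staircase k E u →
    Σ ℕ λ m → m ≤ u × Σ ℕ λ x → Between x (E m) (E (suc m)) × v ≡ vertex (k + m) x
  ∈-staircase k E u (here eq) = 0 , z≤n , E 0 , Between-left (E 0) (E 1) , trans eq (cong (λ z → vertex z (E 0)) (sym (+-identityʳ k)))
  ∈-staircase k E (suc u) (there v∈) with ∈-walk k (E 0) (E 1) v∈
  ... | inj₁ (x , btw , eq) = 0 , z≤n , x , btw , trans eq (cong (λ z → vertex z x) (sym (+-identityʳ k)))
  ... | inj₂ v∈rest with ∈-staircase (suc k) (E ∘ suc) u v∈rest
  ... | m , m≤u , x , btw , eq = suc m , s≤s m≤u , x , btw , trans eq (cong (λ z → vertex z x) (sym (+-suc k m)))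

  row-fresh : ∀ {k tl} x → k < r → All (λ v → k < row v) tl → vertex k x ∉ tl
  row-fresh x k<r above v∈ = <-irrefl (sym (row-vertex x k<r)) (All.lookup above v∈)

  walkRight-fresh : ∀ k a n {tl} → k < r → n < N → All (λ v → k < row v) tl → vertex k a ∉ walkRight k a n tl
  walkRight-fresh k a n k<r n<N above v∈ with ∈-walkRight k a n v∈
  ... | inj₁ (x , a<x , x≤n+a , eq) =
        ≋-window a<x (≤-<-trans x≤n+a (subst (n + a <_) (+-comm N a) (+-monoˡ-< a n<N))) (vertex-col-≋ {k} {k} {a} {x} eq)
  ... | inj₂ v∈tl = row-fresh a k<r above v∈tl

  walkLeft-fresh : ∀ k b n {tl} → k < r → n < N → All (λ v → k < row v) tl → vertex k (n + b) ∉ walkLeft k b n tl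
  walkLeft-fresh k b n k<r n<N above v∈ with ∈-walkLeft k b n v∈
  ... | inj₁ (x , b≤x , x<n+b , eq) =
        ≋-window x<n+b (<-≤-trans (+-monoˡ-< b n<N) (subst (N + b ≤_) (+-comm N x) (+-monoʳ-≤ N b≤x))) (sym (vertex-col-≋ {k} {k} {n + b} {x} eq))
  ... | inj₂ v∈tl = row-fresh (n + b) k<r above v∈tl

  walkRight-unique : ∀ k a n {tl} → k < r → n < N → All (λ v → k < row v) tl → Unique tl →
    Unique (vertex k a ∷ walkRight k a n tl)
  walkRight-unique k a zero k<r n<N above U = ¬Any⇒All¬ _ (walkRight-fresh k a zero k<r n<N above) ∷ U
  walkRight-unique k a (suc n) k<r n<N above U =
    ¬Any⇒All¬ _ (walkRight-fresh k a (suc n) k<r n<N above) ∷ walkRight-unique k (suc a) n k<r (<⇒≤ n<N) above U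

  walkLeft-unique : ∀ k b n {tl} → k < r → n < N → All (λ v → k < row v) tl → Unique tl →
    Unique (vertex k (n + b) ∷ walkLeft k b n tl)
  walkLeft-unique k b zero k<r n<N above U = ¬Any⇒All¬ _ (walkLeft-fresh k b zero k<r n<N above) ∷ U
  walkLeft-unique k b (suc n) k<r n<N above U =
    ¬Any⇒All¬ _ (walkLeft-fresh k b (suc n) k<r n<N above) ∷ walkLeft-unique k b n k<r (<⇒≤ n<N) above U

  walk-unique : ∀ k a b {tl} → k < r → b ∸ a < N → a ∸ b < N → All (λ v → k < row v) tl → Unique tl →
    Unique (vertex k a ∷ walk k a b tl)
  walk-unique k a b {tl} k<r b∸a<N a∸b<N above U with a ≤? b
  ... | yes _ = walkRight-unique k a (b ∸ a) k<r b∸a<N above U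
  ... | no a≰b = subst (λ z → Unique (vertex k z ∷ walkLeft k b (a ∸ b) tl)) (m∸n+n≡m (≰⇒≥ a≰b))
                       (walkLeft-unique k b (a ∸ b) k<r a∸b<N above U)

  staircase-unique : ∀ k E u → k + u < r → (∀ m → m < u → E (suc m) ∸ E m < N × E m ∸ E (suc m) < N) →
    Unique (staircase k E u)
  staircase-unique k E zero _ _ = [] ∷ []
  staircase-unique k E (suc u) k+u<r short =
    walk-unique k (E 0) (E 1) (≤-<-trans (m≤m+n k (suc u)) k+u<r) (proj₁ (short 0 (s≤s z≤n))) (proj₂ (short 0 (s≤s z≤n)))
      (staircase-rows-above (suc k) (E ∘ suc) u 1+k+u<r)
      (staircase-unique (suc k) (E ∘ suc) u 1+k+u<r (λ m m<u → short (suc m) (s≤s m<u)))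
    where
      1+k+u<r = subst (_< r) (+-suc k u) k+u<r

  walkRight-lastOr : ∀ k a n z y ys → lastOr z (walkRight k a n (y ∷ ys)) ≡ lastOr y ys
  walkRight-lastOr k a zero z y ys = refl
  walkRight-lastOr k a (suc n) z y ys = walkRight-lastOr k (suc a) n _ y ys

  walkLeft-lastOr : ∀ k b n z y ys → lastOr z (walkLeft k b n (y ∷ ys)) ≡ lastOr y ys
  walkLeft-lastOr k b zero z y ys = refl
  walkLeft-lastOr k b (suc n) z y ys = walkLeft-lastOr k b n _ y ys

  walk-lastOr : ∀ k a b z y ys → lastOr z (walk k a b (y ∷ ys)) ≡ lastOr y ys
  walk-lastOr k a b z y ys with a ≤? b
  ... | yes _ = walkRight-lastOr k a (b ∸ a) z y ys
  ... | no _ = walkLeft-lastOr k b (a ∸ b) z y ys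

  climb-lastOr : ∀ k E u → lastOr (vertex k (E 0)) (climb k E u) ≡ vertex (k + u) (E u)
  climb-lastOr k E zero = cong (λ z → vertex z (E 0)) (sym (+-identityʳ k))
  climb-lastOr k E (suc u) = begin
    lastOr (vertex k (E 0)) (climb k E (suc u))          ≡⟨ walk-lastOr k (E 0) (E 1) _ _ _ ⟩
    lastOr (vertex (suc k) (E 1)) (climb (suc k) (E ∘ suc) u) ≡⟨ climb-lastOr (suc k) (E ∘ suc) u ⟩
    vertex (suc k + u) (E (suc u))                        ≡⟨ cong (λ z → vertex z (E (suc u))) (sym (+-suc k u)) ⟩
    vertex (k + suc u) (E (suc u))                        ∎
    where open ≡-Reasoning

  staircase-ends : ∀ k E u → Ends (staircase k E u) (vertex k (E 0)) (vertex (k + u) (E u))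
  staircase-ends k E u = climb k E u , refl , climb-lastOr k E u

  M : ℕ
  M = N ∸ 1

  -- M plays the role of the step -1 modulo N
  data Dir : ℕ → Set where
    forward : Dir 1
    backward : Dir M

  Progression : ℕ → ℕ → List (Vertex r) → Set
  Progression σ b [] = ⊤
  Progression σ b (v ∷ vs) = col v ≡ b % N × Progression σ (b + σ) vs

  Progression-≋ : ∀ {σ b b′} vs → b ≋ b′ → Progression σ b vs → Progression σ b′ vs
  Progression-≋ [] _ _ = tt
  Progression-≋ {σ} {b} {b′} (v ∷ vs) b≋b′ (v-col , prog) = trans v-col b≋b′ , Progression-≋ vs (≋-+ʳ {b} {b′} σ b≋b′) prog

  col-% : ∀ v → col v ≡ col v % N
  col-% v = sym (m<n⇒m%n≡m (toℕ<n (proj₂ v)))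

  col-≋ : ∀ v x → col v ≡ x % N → col v ≋ x
  col-≋ v x v-col = trans (sym (col-% v)) v-col

  same-position : ∀ {v w : Vertex r} → proj₁ v ≡ proj₁ w → col v ≡ col w → v ≡ w
  same-position {a , b} {.a , c} refl b≡c = cong (a ,_) (toℕ-injective b≡c)

  adj-in-row : ∀ {v w} → proj₁ v ≡ proj₁ w → Adj r v w → Σ ℕ λ σ → Dir σ × col w ≡ (col v + σ) % N
  adj-in-row {a , b} {a′ , b′} _ (inj₁ (_ , inj₁ succ)) = 1 , forward , trans (cycSucc-col succ) (cong (_% N) (+-comm 1 (toℕ b)))
  adj-in-row {a , b} {a′ , b′} _ (inj₁ (_ , inj₂ back)) = M , backward , sym (begin
    (toℕ b + M) % N               ≡⟨ cong (λ z → (z + M) % N) (cycSucc-col back) ⟩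
    (suc (toℕ b′) % N + M) % N    ≡⟨ ≋-+ʳ {suc (toℕ b′) % N} {suc (toℕ b′)} M (%-≋ (suc (toℕ b′))) ⟩
    (suc (toℕ b′) + M) % N        ≡⟨ cong (_% N) (+-suc (toℕ b′) M) ⟨
    (toℕ b′ + N) % N              ≡⟨ +N-≋ (toℕ b′) ⟩
    toℕ b′ % N                    ≡⟨ col-% (a′ , b′) ⟨
    toℕ b′                        ∎)
    where open ≡-Reasoning
  adj-in-row {a , _} a≡a′ (inj₂ (_ , inj₁ (_ , a′≡1+a))) = ⊥-elim (1+n≢n (trans (sym a′≡1+a) (cong toℕ (sym a≡a′))))
  adj-in-row {a , _} a≡a′ (inj₂ (_ , inj₂ (_ , 1+a′≡a))) = ⊥-elim (1+n≢n (trans 1+a′≡a (cong toℕ a≡a′)))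

  no-reversal : ∀ {k} {v w x} → InRow k v → InRow k x → v ≢ x → ∀ σ τ → σ + τ ≡ N →
    col w ≡ (col v + σ) % N → col x ≡ (col w + τ) % N → ⊥
  no-reversal {v = v} {w} {x} v∈k x∈k v≢x σ τ σ+τ≡N w-col x-col =
    v≢x (same-position (trans v∈k (sym x∈k)) (sym (begin
      col x                 ≡⟨ x-col ⟩
      (col w + τ) % N       ≡⟨ ≋-+ʳ {col w} {col v + σ} τ (col-≋ w (col v + σ) w-col) ⟩
      (col v + σ + τ) % N   ≡⟨ cong (_% N) (trans (+-assoc (col v) σ τ) (cong (col v +_) σ+τ≡N)) ⟩
      (col v + N) % N       ≡⟨ +N-≋ (col v) ⟩
      col v % N             ≡⟨ col-% v ⟨
      col v                 ∎)))
    where open ≡-Reasoning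

  row-path-progression : ∀ {k} v vs → All (InRow k) (v ∷ vs) → Linked (Adj r) (v ∷ vs) → Unique (v ∷ vs) →
    Σ ℕ λ σ → Dir σ × Progression σ (col v) (v ∷ vs)
  row-path-progression v [] _ _ _ = 1 , forward , col-% v , tt
  row-path-progression v (w ∷ []) (v∈k ∷ w∈k ∷ []) (vw ∷ _) _ with adj-in-row (trans v∈k (sym w∈k)) vw
  ... | σ , dir , w-col = σ , dir , col-% v , w-col , tt
  row-path-progression v (w ∷ x ∷ xs) (v∈k ∷ w∈k ∷ rest∈k) (vw ∷ L) ((_ ∷ v≢x ∷ _) ∷ U)
    with adj-in-row (trans v∈k (sym w∈k)) vw | row-path-progression w (x ∷ xs) (w∈k ∷ rest∈k) L U
  ... | σ , forward , w-col | _ , forward , prog =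
        σ , forward , col-% v , Progression-≋ {b = col w} {b′ = col v + σ} (w ∷ x ∷ xs) (col-≋ w (col v + σ) w-col) prog
  ... | σ , backward , w-col | _ , backward , prog =
        σ , backward , col-% v , Progression-≋ {b = col w} {b′ = col v + σ} (w ∷ x ∷ xs) (col-≋ w (col v + σ) w-col) prog
  ... | _ , forward , w-col | _ , backward , (_ , x-col , _) =
        ⊥-elim (no-reversal {v = v} {w} {x} v∈k (All.head rest∈k) v≢x 1 M refl w-col x-col)
  ... | _ , backward , w-col | _ , forward , (_ , x-col , _) =
        ⊥-elim (no-reversal {v = v} {w} {x} v∈k (All.head rest∈k) v≢x M 1 (+-comm M 1) w-col x-col)

  progression-∈ : ∀ {k : Fin r} {σ b} S → All (InRow k) S → Progression σ b S → ∀ l → l < length S →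
    vertex (toℕ k) (b + l * σ) ∈ S
  progression-∈ {k} {σ} {b} (v ∷ S) (v∈k ∷ _) (v-col , _) zero _ =
    here (vertex-η v (b + 0) v∈k (trans v-col (cong (_% N) (sym (+-identityʳ b)))))
  progression-∈ {k} {σ} {b} (v ∷ S) (_ ∷ S∈k) (_ , prog) (suc l) (s≤s l<) =
    there (subst (λ z → vertex (toℕ k) z ∈ S) (reassoc b σ l) (progression-∈ S S∈k prog l l<))
    where
      reassoc : ∀ b σ l → b + σ + l * σ ≡ b + suc l * σ
      reassoc = solve-∀

  -- b + T * M stands for b - T, so l backward steps from b reach (b - T) + l′
  backward-column : ∀ b l l′ T → l + l′ ≡ T → b + l * M ≋ b + T * M + l′
  backward-column b l l′ T l+l′≡T = begin
    (b + l * M) % N                ≡⟨ [m+kn]%n≡m%n (b + l * M) l′ N ⟨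
    (b + l * M + l′ * suc M) % N   ≡⟨ cong (_% N) (regroup b l l′ M) ⟩
    (b + (l + l′) * M + l′) % N    ≡⟨ cong (λ z → (b + z * M + l′) % N) l+l′≡T ⟩
    (b + T * M + l′) % N           ∎
    where
      open ≡-Reasoning
      regroup : ∀ b l l′ M → b + l * M + l′ * suc M ≡ b + (l + l′) * M + l′
      regroup = solve-∀

  spaced-index-≤ : ∀ o s t → o ≤ 1 → s < t → o + 2 * s ≤ 2 * t ∸ 1
  spaced-index-≤ o s t o≤1 s<t =
    ≤-trans (+-monoˡ-≤ (2 * s) o≤1) (subst (_≤ 2 * t ∸ 1) (cong (_∸ 1) (*-suc 2 s)) (∸-monoˡ-≤ 1 (*-monoʳ-≤ 2 s<t)))

  -- the edge from (k , x) up to row k + 1 exists iff k + x is even, hence the prescribed parity of p + c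
  spaced-columns : ∀ (k : Fin r) p t S → IsPath r S → All (InRow k) S → 2 * t ∸ 1 ≤ edgeLength S →
    Σ ℕ λ c → 2 ∣ p + c × (∀ s → s < t → vertex (toℕ k) (c + 2 * s) ∈ S)
  spaced-columns k p zero S _ _ _ = p , divides p (trans (cong (p +_) (sym (+-identityʳ p))) (*-comm 2 p)) , λ _ ()
  spaced-columns k p (suc t) (v ∷ vs) (_ , U , L) S∈k len with row-path-progression v vs S∈k L U
  ... | σ , forward , prog = col v + o , 2∣p+c , members
    where
      S = v ∷ vs
      o = proj₁ (parity-offset p (col v))
      o≤1 = proj₁ (proj₂ (parity-offset p (col v)))
      2∣p+c = proj₂ (proj₂ (parity-offset p (col v)))
      members : ∀ s → s < suc t → vertex (toℕ k) (col v + o + 2 * s) ∈ S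
      members s s<t = subst (λ z → vertex (toℕ k) z ∈ S) (reassoc (col v) o s)
        (progression-∈ {b = col v} S S∈k prog (o + 2 * s) (s≤s (≤-trans (spaced-index-≤ o s (suc t) o≤1 s<t) len)))
        where
          reassoc : ∀ b o s → b + (o + 2 * s) * 1 ≡ b + o + 2 * s
          reassoc = solve-∀
  ... | σ , backward , prog = a + o , 2∣p+c , members
    where
      S = v ∷ vs
      T = 2 * suc t ∸ 1
      a = col v + T * M
      o = proj₁ (parity-offset p a)
      o≤1 = proj₁ (proj₂ (parity-offset p a))
      2∣p+c = proj₂ (proj₂ (parity-offset p a))
      members : ∀ s → s < suc t → vertex (toℕ k) (a + o + 2 * s) ∈ S
      members s s<t = subst (_∈ S)
        (vertex-cong (toℕ k) {col v + (T ∸ l′) * M} {a + o + 2 * s}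
          (trans (backward-column (col v) (T ∸ l′) l′ T (m∸n+n≡m l′≤T)) (cong (_% N) (sym (+-assoc a o (2 * s))))))
        (progression-∈ {b = col v} S S∈k prog (T ∸ l′) (s≤s (≤-trans (m∸n≤m T l′) len)))
        where
          l′ = o + 2 * s
          l′≤T = spaced-index-≤ o s (suc t) o≤1 s<t

  Linkage : Fin r → Fin r → ℕ → List (Vertex r) → List (Vertex r) → Set
  Linkage i j t Si Sj = Σ (Fin t → List (Vertex r)) λ P →
    ((a : Fin t) → IsPath r (P a) × Links (P a) Si Sj)
    × ((a b : Fin t) → a ≢ b → Disjoint (P a) (P b))
    × ((a : Fin t) (k : Fin r) → toℕ i < toℕ k → toℕ k < toℕ j → SegmentOn k (P a))

  -- path s will be staircase (toℕ i) (column s) (suc t); apart-around keeps the column intervals disjoint modulo N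
  record Routing (i j : Fin r) (t : ℕ) (Si Sj : List (Vertex r)) : Set where
    field
      column lo hi : ℕ → ℕ → ℕ
      starts : ∀ s → s < t → vertex (toℕ i) (column s 0) ∈ Si
      ends : ∀ s → s < t → vertex (toℕ j) (column s (suc t)) ∈ Sj
      climbable : ∀ s → s < t → ∀ m → m < suc t → 2 ∣ (toℕ i + m) + column s (suc m)
      short : ∀ s → s < t → ∀ m → m < suc t → column s (suc m) ∸ column s m < N × column s m ∸ column s (suc m) < N
      within : ∀ s → s < t → ∀ m → m ≤ suc t → ∀ x → Between x (column s m) (column s (suc m)) → lo s m ≤ x × x ≤ hi s m
      apart : ∀ s s′ m → s < s′ → s′ < t → m ≤ suc t → hi s m < lo s′ m
      apart-around : ∀ s s′ m → s < s′ → s′ < t → m ≤ suc t → hi s′ m < lo s m + N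

  module _ {i j : Fin r} {t : ℕ} {Si Sj : List (Vertex r)} (j≡i+1+t : toℕ j ≡ toℕ i + suc t) (R : Routing i j t Si Sj) where
    open Routing R

    private
      i+1+t<r : toℕ i + suc t < r
      i+1+t<r = subst (_< r) j≡i+1+t (toℕ<n j)

      path : ℕ → List (Vertex r)
      path s = staircase (toℕ i) (column s) (suc t)

      1+i+m<r : ∀ m → m < suc t → suc (toℕ i + m) < r
      1+i+m<r m m<1+t = ≤-<-trans (subst (suc (toℕ i + m) ≤_) (sym (+-suc (toℕ i) t)) (s≤s (+-monoʳ-≤ (toℕ i) (≤-pred m<1+t)))) i+1+t<r

      path-isPath : ∀ s → s < t → IsPath r (path s)
      path-isPath s s<t = s≤s z≤n , staircase-unique (toℕ i) (column s) (suc t) i+1+t<r (short s s<t) ,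
        staircase-linked (toℕ i) (column s) (suc t)
          (λ m m<1+t → adj-up (toℕ i + m) (column s (suc m)) (1+i+m<r m m<1+t) (climbable s s<t m m<1+t))
        where open WalkLinked (Adj r) adj-right adj-left

      path-links : ∀ s → s < t → Links (path s) Si Sj
      path-links s s<t = _ , _ , starts s s<t , ends s s<t ,
        subst (Ends (path s) _) (cong (λ k → vertex k (column s (suc t))) (sym j≡i+1+t)) (staircase-ends (toℕ i) (column s) (suc t))

      paths-disjoint : ∀ s s′ → s < s′ → s′ < t → Disjoint (path s) (path s′)
      paths-disjoint s s′ s<s′ s′<t v v∈s v∈s′
        with ∈-staircase (toℕ i) (column s) (suc t) v∈s | ∈-staircase (toℕ i) (column s′) (suc t) v∈s′
      ... | m , m≤ , x , x-btw , v≡ | m′ , m′≤ , x′ , x′-btw , v≡′ =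
        ≋-window x<x′ x′<x+N (vertex-col-≋ {k₀ + m} {k₀ + m} {x} {x′}
          (trans (sym v≡) (trans v≡′ (cong (λ k → vertex k x′) (sym same-row)))))
        where
          k₀ = toℕ i
          same-row : k₀ + m ≡ k₀ + m′
          same-row = vertex-row-≡ {x = x} {x′} (≤-<-trans (+-monoʳ-≤ k₀ m≤) i+1+t<r) (≤-<-trans (+-monoʳ-≤ k₀ m′≤) i+1+t<r)
                                  (trans (sym v≡) v≡′)
          x′-btw′ : Between x′ (column s′ m) (column s′ (suc m))
          x′-btw′ = subst (λ z → Between x′ (column s′ z) (column s′ (suc z))) (sym (+-cancelˡ-≡ k₀ m m′ same-row)) x′-btw
          x-in = within s (<-trans s<s′ s′<t) m m≤ x x-btw
          x′-in = within s′ s′<t m m≤ x′ x′-btw′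
          x<x′ : x < x′
          x<x′ = <-≤-trans (≤-<-trans (proj₂ x-in) (apart s s′ m s<s′ s′<t m≤)) (proj₁ x′-in)
          x′<x+N : x′ < x + N
          x′<x+N = ≤-<-trans (proj₂ x′-in) (<-≤-trans (apart-around s s′ m s<s′ s′<t m≤) (+-monoˡ-≤ N (proj₁ x-in)))

    routing-linkage : Linkage i j t Si Sj
    routing-linkage = P , (λ a → path-isPath (toℕ a) (toℕ<n a) , path-links (toℕ a) (toℕ<n a)) , disjoint , segments
      where
        P : Fin t → List (Vertex r)
        P a = path (toℕ a)
        disjoint : (a b : Fin t) → a ≢ b → Disjoint (P a) (P b)
        disjoint a b a≢b v v∈a v∈b with <-cmp (toℕ a) (toℕ b)
        ... | tri< a<b _ _ = paths-disjoint (toℕ a) (toℕ b) a<b (toℕ<n b) v v∈a v∈b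
        ... | tri≈ _ a≡b _ = a≢b (toℕ-injective a≡b)
        ... | tri> _ _ b<a = paths-disjoint (toℕ b) (toℕ a) b<a (toℕ<n a) v v∈b v∈a
        segments : (a : Fin t) (k : Fin r) → toℕ i < toℕ k → toℕ k < toℕ j → SegmentOn k (P a)
        segments a k _ _ = staircase-segment (toℕ i) (column (toℕ a)) (suc t) i+1+t<r k

  2≤N : 2 ≤ N
  2≤N = *-monoʳ-≤ 2 (s≤s z≤n)

  Adjacent⇒short : ∀ {a b} → Adjacent a b → b ∸ a < N × a ∸ b < N
  Adjacent⇒short adj = <-≤-trans (s≤s (proj₁ (Adjacent-∸ adj))) 2≤N , <-≤-trans (s≤s (proj₂ (Adjacent-∸ adj))) 2≤N

  record Terminals (i j : Fin r) (t : ℕ) (Si Sj : List (Vertex r)) : Set where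
    field
      c e : ℕ
      even-start : 2 ∣ toℕ i + c
      sources : ∀ s → s < t → vertex (toℕ i) (c + 2 * s) ∈ Si
      targets : ∀ s → s < t → vertex (toℕ j) (e + 2 * s) ∈ Sj

  -- the offset N keeps the leftward columns B + 2p - m from being truncated
  module Tent {i j : Fin r} {t : ℕ} {Si Sj : List (Vertex r)} (t<r : t < r) (T : Terminals i j t Si Sj) (p : ℕ) where
    open Terminals T

    B : ℕ
    B = c + N

    W : ℕ → ℕ
    W m with m ≤? p
    ... | yes _ = B + m
    ... | no _ = B + 2 * p ∸ m

    W-zero : W 0 ≡ B + 0
    W-zero with 0 ≤? p
    ... | yes _ = refl
    ... | no 0≰p = ⊥-elim (0≰p z≤n)

    W-adjacent : ∀ m → m < B → Adjacent (W m) (W (suc m))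
    W-adjacent m m<B with m ≤? p | suc m ≤? p
    ... | yes _ | yes _ = subst (Adjacent (B + m)) (sym (+-suc B m)) (Adjacent-suc (B + m))
    ... | yes m≤p | no 1+m≰p = subst (λ z → Adjacent z (B + 2 * p ∸ suc m)) (sym turn) (Adjacent-sym (Adjacent-suc _))
      where
        m≡p : m ≡ p
        m≡p = ≤-antisym m≤p (≤-pred (≰⇒> 1+m≰p))
        p<B+2p : p < B + 2 * p
        p<B+2p = ≤-trans (s≤s (m≤m+n p (p + 0))) (+-monoˡ-≤ (2 * p) (≤-trans (s≤s z≤n) m<B))
        turn : B + m ≡ suc (B + 2 * p ∸ suc m)
        turn = begin
          B + m                       ≡⟨ cong (B +_) m≡p ⟩
          B + p                       ≡⟨ m+n∸n≡m (B + p) p ⟨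
          B + p + p ∸ p               ≡⟨ cong (_∸ p) (regroup B p) ⟩
          B + 2 * p ∸ p               ≡⟨ m∸n≡1+m∸[1+n] (B + 2 * p) p p<B+2p ⟩
          suc (B + 2 * p ∸ suc p)     ≡⟨ cong (λ z → suc (B + 2 * p ∸ suc z)) m≡p ⟨
          suc (B + 2 * p ∸ suc m)     ∎
          where
            open ≡-Reasoning
            regroup : ∀ B p → B + p + p ≡ B + 2 * p
            regroup = solve-∀
    ... | no m≰p | yes 1+m≤p = ⊥-elim (m≰p (≤-trans (n≤1+n m) 1+m≤p))
    ... | no _ | no _ = Adjacent-sym (subst (Adjacent (B + 2 * p ∸ suc m))
                          (sym (m∸n≡1+m∸[1+n] (B + 2 * p) m (≤-trans m<B (m≤m+n B (2 * p))))) (Adjacent-suc _))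

    W-parity : ∀ m → m < B → Σ ℕ λ q → W m + m ≡ B + 2 * q
    W-parity m m<B with m ≤? p
    ... | yes _ = m , regroup B m
      where
        regroup : ∀ B m → B + m + m ≡ B + 2 * m
        regroup = solve-∀
    ... | no _ = p , m∸n+n≡m (≤-trans (<⇒≤ m<B) (m≤m+n B (2 * p)))

    W-end : p ≤ t → t < B → W t + t ≡ B + 2 * p
    W-end p≤t t<B with t ≤? p
    ... | yes t≤p = trans (regroup B t) (cong (λ z → B + 2 * z) (≤-antisym t≤p p≤t))
      where
        regroup : ∀ B m → B + m + m ≡ B + 2 * m
        regroup = solve-∀
    ... | no _ = m∸n+n≡m (≤-trans (<⇒≤ t<B) (m≤m+n B (2 * p)))

    t<B : t < B
    t<B = ≤-trans t<r (≤-trans (m≤m+n r (r + 0)) (m≤n+m N c))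

    W-step : ∀ m → m ≤ suc t → Adjacent (W (pred m)) (W m)
    W-step zero _ = Adjacent-refl (W 0)
    W-step (suc m) (s≤s m≤t) = W-adjacent m (≤-<-trans m≤t t<B)

    column : ℕ → ℕ → ℕ
    column s m = W (pred m) + 2 * s

    L : ℕ → ℕ
    L m = W (pred m) ⊓ W m

    column-start≋ : ∀ s → c + 2 * s ≋ column s 0
    column-start≋ s = begin
      (c + 2 * s) % N           ≡⟨ +N-≋ (c + 2 * s) ⟨
      (c + 2 * s + N) % N       ≡⟨ cong (_% N) (regroup c s N) ⟩
      (B + 0 + 2 * s) % N       ≡⟨ cong (λ z → (z + 2 * s) % N) W-zero ⟨
      (W 0 + 2 * s) % N         ∎
      where
        open ≡-Reasoning
        regroup : ∀ c s N → c + 2 * s + N ≡ c + N + 0 + 2 * s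
        regroup = solve-∀

    column-climbable : ∀ s m → m < suc t → 2 ∣ (toℕ i + m) + column s (suc m)
    column-climbable s m m<1+t with W-parity m (≤-<-trans (≤-pred m<1+t) t<B)
    ... | q , W+m≡ = subst (2 ∣_) (sym (begin
          (toℕ i + m) + (W m + 2 * s)          ≡⟨ regroup₁ (toℕ i) m (W m) s ⟩
          toℕ i + (W m + m) + 2 * s            ≡⟨ cong (λ z → toℕ i + z + 2 * s) W+m≡ ⟩
          toℕ i + (c + 2 * r + 2 * q) + 2 * s  ≡⟨ regroup₂ (toℕ i) c r q s ⟩
          (toℕ i + c) + 2 * (r + q + s)        ∎))
        (∣m∣n⇒∣m+n even-start (divides (r + q + s) (*-comm 2 (r + q + s))))
      where
        open ≡-Reasoning
        regroup₁ : ∀ i m w s → (i + m) + (w + 2 * s) ≡ i + (w + m) + 2 * s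
        regroup₁ = solve-∀
        regroup₂ : ∀ i c r q s → i + (c + 2 * r + 2 * q) + 2 * s ≡ (i + c) + 2 * (r + q + s)
        regroup₂ = solve-∀

    tent-routing : ∀ w → p ≤ t → w + t ≡ B + 2 * p → w ≋ e → Routing i j t Si Sj
    tent-routing w p≤t w+t≡ w≋e = record
      { column = column
      ; lo = λ s m → L m + 2 * s
      ; hi = λ s m → suc (L m + 2 * s)
      ; starts = λ s s<t → subst (_∈ Si) (vertex-cong (toℕ i) {c + 2 * s} {column s 0} (column-start≋ s)) (sources s s<t)
      ; ends = λ s s<t → subst (_∈ Sj) (vertex-cong (toℕ j) {e + 2 * s} {column s (suc t)} (≋-+ʳ {e} {W t} (2 * s) end≋))
                                (targets s s<t)
      ; climbable = λ s _ → column-climbable s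
      ; short = λ s _ m m<1+t → Adjacent⇒short (Adjacent-+ʳ (2 * s) (W-step m (<⇒≤ m<1+t)))
      ; within = λ s _ m m≤1+t x → Between-⊓ (2 * s) (W-step m m≤1+t)
      ; apart = λ s s′ m s<s′ _ _ → n<o⇒2+[m+2*n]≤m+2*o (L m) s<s′
      ; apart-around = λ s s′ m _ s′<t _ → ≤-trans (n<o⇒2+[m+2*n]≤m+2*o (L m) (<-trans s′<t t<r))
          (subst (L m + N ≤_) (sym (+-assoc (L m) (2 * s) N)) (+-monoʳ-≤ (L m) (m≤n+m N (2 * s))))
      }
      where
        end≋ : e ≋ W t
        end≋ = trans (sym w≋e) (cong (_% N) (+-cancelʳ-≡ t w (W t) (trans w+t≡ (sym (W-end p≤t t<B)))))

  -- path s moves one column per row, plus G = D - t extra columns in the row where s + m reaches t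
  module Jump {i j : Fin r} {t : ℕ} {Si Sj : List (Vertex r)} (t<r : t < r) (T : Terminals i j t Si Sj)
    (D : ℕ) (t≤D : t ≤ D) (D+t≤N : D + t ≤ N) (2∣G : 2 ∣ D ∸ t) where
    open Terminals T

    B G : ℕ
    B = c + N
    G = D ∸ t

    jump : ℕ → ℕ
    jump n with t ≤? n
    ... | yes _ = G
    ... | no _ = 0

    jump-mono : ∀ {m n} → m ≤ n → jump m ≤ jump n
    jump-mono {m} {n} m≤n with t ≤? m | t ≤? n
    ... | yes _ | yes _ = ≤-refl
    ... | yes t≤m | no t≰n = ⊥-elim (t≰n (≤-trans t≤m m≤n))
    ... | no _ | _ = z≤n

    jump-≤ : ∀ n → jump n ≤ G
    jump-≤ n with t ≤? n
    ... | yes _ = ≤-refl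
    ... | no _ = z≤n

    jump-even : ∀ n → 2 ∣ jump n
    jump-even n with t ≤? n
    ... | yes _ = 2∣G
    ... | no _ = divides 0 refl

    jump-below : ∀ n → n < t → jump n ≡ 0
    jump-below n n<t with t ≤? n
    ... | yes t≤n = ⊥-elim (<⇒≱ n<t t≤n)
    ... | no _ = refl

    jump-above : ∀ n → t ≤ n → jump n ≡ G
    jump-above n t≤n with t ≤? n
    ... | yes _ = refl
    ... | no t≰n = ⊥-elim (t≰n t≤n)

    F : ℕ → ℕ → ℕ
    F s m = B + 2 * s + m + jump (s + m)

    F-pred-≤ : ∀ s m → F s (pred m) ≤ F s m
    F-pred-≤ s m = +-mono-≤ (+-monoʳ-≤ (B + 2 * s) pred[n]≤n) (jump-mono (+-monoʳ-≤ s pred[n]≤n))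

    B+m≤F : ∀ s m → B + m ≤ F s m
    B+m≤F s m = ≤-trans (+-monoˡ-≤ m (m≤m+n B (2 * s))) (m≤m+n (B + 2 * s + m) (jump (s + m)))

    F-step : ∀ s m → F s m ≤ F s (pred m) + suc G
    F-step s m = begin
      B + 2 * s + m + jump (s + m)               ≤⟨ +-mono-≤ (+-monoʳ-≤ (B + 2 * s) (m≤suc[pred[m]] m)) (jump-≤ (s + m)) ⟩
      B + 2 * s + suc (pred m) + G            ≡⟨ regroup B s (pred m) G ⟩
      B + 2 * s + pred m + suc G              ≤⟨ +-monoˡ-≤ (suc G) (m≤m+n (B + 2 * s + pred m) (jump (s + pred m))) ⟩
      F s (pred m) + suc G                    ∎
      where
        open ≤-Reasoning
        regroup : ∀ B s p G → B + 2 * s + suc p + G ≡ B + 2 * s + p + suc G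
        regroup = solve-∀

    t+G≡D : t + G ≡ D
    t+G≡D = m+[n∸m]≡n t≤D

    1+G<N : 0 < t → suc G < N
    1+G<N 0<t = ≤-trans (subst (suc (suc G) ≤_) (trans (regroup t G) (cong (_+ t) t+G≡D)) (+-monoˡ-≤ G (+-mono-≤ 0<t 0<t))) D+t≤N
      where
        regroup : ∀ t G → t + t + G ≡ t + G + t
        regroup = solve-∀

    F-apart : ∀ s s′ m → s < s′ → F s m < F s′ (pred m)
    F-apart s s′ m s<s′ = begin-strict
      B + 2 * s + m + jump (s + m)            ≡⟨ cong (_+ jump (s + m)) (+-assoc B (2 * s) m) ⟩
      B + (2 * s + m) + jump (s + m)          <⟨ +-monoˡ-< (jump (s + m)) (+-monoʳ-< B columns<) ⟩
      B + (2 * s′ + pred m) + jump (s + m)    ≡⟨ cong (_+ jump (s + m)) (+-assoc B (2 * s′) (pred m)) ⟨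
      B + 2 * s′ + pred m + jump (s + m)      ≤⟨ +-monoʳ-≤ (B + 2 * s′ + pred m) (jump-mono s+m≤) ⟩
      F s′ (pred m)                           ∎
      where
        open ≤-Reasoning
        regroup : ∀ p s → suc (suc (p + 2 * s)) ≡ suc (2 * s + suc p)
        regroup = solve-∀
        columns< : 2 * s + m < 2 * s′ + pred m
        columns< = ≤-trans (s≤s (+-monoʳ-≤ (2 * s) (m≤suc[pred[m]] m)))
                           (subst₂ _≤_ (regroup (pred m) s) (+-comm (pred m) (2 * s′)) (n<o⇒2+[m+2*n]≤m+2*o (pred m) s<s′))
        s+m≤ : s + m ≤ s′ + pred m
        s+m≤ = ≤-trans (+-monoʳ-≤ s (m≤suc[pred[m]] m)) (subst (_≤ s′ + pred m) (sym (+-suc s (pred m))) (+-monoˡ-≤ (pred m) s<s′))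

    F-apart-around : ∀ s s′ m → s′ < t → F s′ m < F s (pred m) + N
    F-apart-around s s′ m s′<t = begin-strict
      F s′ m                                  ≤⟨ +-mono-≤ (+-monoʳ-≤ (B + 2 * s′) (m≤suc[pred[m]] m)) (jump-≤ (s′ + m)) ⟩
      B + 2 * s′ + suc (pred m) + G           <⟨ n<1+n _ ⟩
      suc (B + 2 * s′ + suc (pred m) + G)     ≡⟨ regroup B s′ (pred m) G ⟩
      B + pred m + (2 * suc s′ + G)           ≤⟨ +-monoʳ-≤ (B + pred m) (+-monoˡ-≤ G (*-monoʳ-≤ 2 s′<t)) ⟩
      B + pred m + (2 * t + G)                ≡⟨ cong (B + pred m +_) (regroup′ t G) ⟩
      B + pred m + (t + (t + G))              ≡⟨ cong (λ z → B + pred m + (t + z)) t+G≡D ⟩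
      B + pred m + (t + D)                    ≤⟨ +-monoʳ-≤ (B + pred m) (subst (_≤ N) (+-comm D t) D+t≤N) ⟩
      B + pred m + N                          ≤⟨ +-monoˡ-≤ N (B+m≤F s (pred m)) ⟩
      F s (pred m) + N                        ∎
      where
        open ≤-Reasoning
        regroup : ∀ B s p G → suc (B + 2 * s + suc p + G) ≡ B + p + (2 * suc s + G)
        regroup = solve-∀
        regroup′ : ∀ t G → 2 * t + G ≡ t + (t + G)
        regroup′ = solve-∀

    column-start≋ : ∀ s → s < t → c + 2 * s ≋ F s 0
    column-start≋ s s<t = begin
      (c + 2 * s) % N                        ≡⟨ +N-≋ (c + 2 * s) ⟨
      (c + 2 * s + N) % N                    ≡⟨ cong (_% N) (regroup c s N) ⟩
      (B + 2 * s + 0 + 0) % N                ≡⟨ cong (λ z → (B + 2 * s + 0 + z) % N) (jump-below (s + 0) s+0<t) ⟨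
      (B + 2 * s + 0 + jump (s + 0)) % N     ∎
      where
        open ≡-Reasoning
        regroup : ∀ c s N → c + 2 * s + N ≡ c + N + 2 * s + 0 + 0
        regroup = solve-∀
        s+0<t = subst (_< t) (sym (+-identityʳ s)) s<t

    column-end≋ : c + D ≋ e → ∀ s → e + 2 * s ≋ F s t
    column-end≋ c+D≋e s = begin
      (e + 2 * s) % N                        ≡⟨ ≋-+ʳ {e} {c + D} (2 * s) (sym c+D≋e) ⟩
      (c + D + 2 * s) % N                    ≡⟨ +N-≋ (c + D + 2 * s) ⟨
      (c + D + 2 * s + N) % N                ≡⟨ cong (λ z → (c + z + 2 * s + N) % N) t+G≡D ⟨
      (c + (t + G) + 2 * s + N) % N          ≡⟨ cong (_% N) (regroup c t G s N) ⟩
      (B + 2 * s + t + G) % N                ≡⟨ cong (λ z → (B + 2 * s + t + z) % N) (jump-above (s + t) (m≤n+m t s)) ⟨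
      F s t % N                              ∎
      where
        open ≡-Reasoning
        regroup : ∀ c t G s N → c + (t + G) + 2 * s + N ≡ c + N + 2 * s + t + G
        regroup = solve-∀

    column-climbable : ∀ s m → 2 ∣ (toℕ i + m) + F s m
    column-climbable s m = subst (2 ∣_) (sym (regroup (toℕ i) m c r s (jump (s + m))))
      (∣m∣n⇒∣m+n (∣m∣n⇒∣m+n even-start (divides (r + s + m) (*-comm 2 (r + s + m)))) (jump-even (s + m)))
      where
        regroup : ∀ i m c r s x → (i + m) + (c + 2 * r + 2 * s + m + x) ≡ (i + c) + 2 * (r + s + m) + x
        regroup = solve-∀

    jump-routing : c + D ≋ e → Routing i j t Si Sj
    jump-routing c+D≋e = record
      { column = λ s m → F s (pred m)
      ; lo = λ s m → F s (pred m)
      ; hi = F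
      ; starts = λ s s<t → subst (_∈ Si) (vertex-cong (toℕ i) {c + 2 * s} {F s 0} (column-start≋ s s<t)) (sources s s<t)
      ; ends = λ s s<t → subst (_∈ Sj) (vertex-cong (toℕ j) {e + 2 * s} {F s t} (column-end≋ c+D≋e s)) (targets s s<t)
      ; climbable = λ s _ m _ → column-climbable s m
      ; short = λ s s<t m _ → ≤-<-trans (m≤n+o⇒m∸n≤o (F s m) (F s (pred m)) (F-step s m)) (1+G<N (≤-<-trans z≤n s<t))
                            , subst (_< N) (sym (m≤n⇒m∸n≡0 (F-pred-≤ s m))) (≤-trans (s≤s z≤n) 2≤N)
      ; within = λ s _ m _ x → Between-bounds ≤-refl (F-pred-≤ s m) (F-pred-≤ s m) ≤-refl
      ; apart = λ s s′ m s<s′ _ _ → F-apart s s′ m s<s′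
      ; apart-around = λ s s′ m _ s′<t _ → F-apart-around s s′ m s′<t
      }

  offset : ∀ c e → Σ ℕ λ D → D < N × c + D ≋ e
  offset c e with c % N ≤? e % N
  ... | yes c%≤e% = e % N ∸ c % N , ≤-<-trans (m∸n≤m (e % N) (c % N)) (m%n<n e N) , (begin
        (c + (e % N ∸ c % N)) % N         ≡⟨ ≋-+ʳ {c} {c % N} (e % N ∸ c % N) (sym (%-≋ c)) ⟩
        (c % N + (e % N ∸ c % N)) % N     ≡⟨ cong (_% N) (m+[n∸m]≡n c%≤e%) ⟩
        e % N % N                         ≡⟨ %-≋ e ⟩
        e % N                             ∎)
    where open ≡-Reasoning
  ... | no c%≰e% = e % N + N ∸ c % N , m<n+o⇒m∸n<o (e % N + N) (c % N) (+-monoˡ-< N (≰⇒> c%≰e%)) , (begin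
        (c + (e % N + N ∸ c % N)) % N     ≡⟨ ≋-+ʳ {c} {c % N} (e % N + N ∸ c % N) (sym (%-≋ c)) ⟩
        (c % N + (e % N + N ∸ c % N)) % N ≡⟨ cong (_% N) (m+[n∸m]≡n (≤-trans (<⇒≤ (m%n<n c N)) (m≤n+m N (e % N)))) ⟩
        (e % N + N) % N                   ≡⟨ +N-≋ (e % N) ⟩
        e % N % N                         ≡⟨ %-≋ e ⟩
        e % N                             ∎)
    where open ≡-Reasoning

  half : ∀ {n} → 2 ∣ n → Σ ℕ λ q → 2 * q ≡ n
  half (divides q n≡q*2) = q , trans (*-comm 2 q) (sym n≡q*2)

  -- this is why the target columns were chosen with the parity of toℕ j + 1
  offset-even : ∀ {i j : Fin r} {t c e D} → toℕ j ≡ toℕ i + suc t →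
    2 ∣ toℕ i + c → 2 ∣ suc (toℕ j) + e → c + D ≋ e → 2 ∣ D + t
  offset-even {i} {j} {t} {c} {e} {D} j≡i+1+t 2∣i+c 2∣1+j+e c+D≋e =
    ∣m+n∣m⇒∣n (∣m+n∣m⇒∣n (subst (2 ∣_) regrouped 2∣1+j+c+D) (divides 1 refl)) 2∣i+c
    where
      2∣1+j+c+D : 2 ∣ suc (toℕ j) + (c + D)
      2∣1+j+c+D = ∣-+-≋ 2∣N (suc (toℕ j)) {e} {c + D} (sym c+D≋e) 2∣1+j+e
      regroup : ∀ i t c D → suc (i + suc t) + (c + D) ≡ 2 + ((i + c) + (D + t))
      regroup = solve-∀
      regrouped : suc (toℕ j) + (c + D) ≡ 2 + ((toℕ i + c) + (D + t))
      regrouped = trans (cong (λ z → suc z + (c + D)) j≡i+1+t) (regroup (toℕ i) t c D)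

  module _ {i j : Fin r} {t : ℕ} {Si Sj : List (Vertex r)} (j≡i+1+t : toℕ j ≡ toℕ i + suc t)
    (T : Terminals i j t Si Sj) {D q : ℕ} (D<N : D < N) (c+D≋e : Terminals.c T + D ≋ Terminals.e T)
    (2q≡D+t : 2 * q ≡ D + t) where
    open Terminals T

    private
      t<r : t < r
      t<r = ≤-trans (m≤n+m (suc t) (toℕ i)) (<⇒≤ (subst (_< r) j≡i+1+t (toℕ<n j)))

    small-offset-linkage : D < t → Linkage i j t Si Sj
    small-offset-linkage D<t = routing-linkage j≡i+1+t (Tent.tent-routing t<r T q (c + N + D) q≤t end-eq end≋)
      where
        regroup₁ : ∀ t → t + t ≡ 2 * t
        regroup₁ = solve-∀
        regroup₂ : ∀ c N D → c + N + D ≡ c + D + N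
        regroup₂ = solve-∀
        q≤t : q ≤ t
        q≤t = *-cancelˡ-≤ 2 (subst (_≤ 2 * t) (sym 2q≡D+t) (subst (D + t ≤_) (regroup₁ t) (+-monoˡ-≤ t (<⇒≤ D<t))))
        end-eq : c + N + D + t ≡ c + N + 2 * q
        end-eq = trans (+-assoc (c + N) D t) (cong (c + N +_) (sym 2q≡D+t))
        end≋ : c + N + D ≋ e
        end≋ = trans (cong (_% N) (regroup₂ c N D)) (trans (+N-≋ (c + D)) c+D≋e)

    medium-offset-linkage : t ≤ D → D + t ≤ N → Linkage i j t Si Sj
    medium-offset-linkage t≤D D+t≤N = routing-linkage j≡i+1+t (Jump.jump-routing t<r T D t≤D D+t≤N 2∣D∸t c+D≋e)
      where
        regroup : ∀ t G → 2 * t + G ≡ t + (t + G)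
        regroup = solve-∀
        2∣D∸t : 2 ∣ D ∸ t
        2∣D∸t = ∣m+n∣m⇒∣n (subst (2 ∣_) 2t+[D∸t]≡2q (divides q (*-comm 2 q))) (m∣m*n t)
          where
            2t+[D∸t]≡2q : 2 * q ≡ 2 * t + (D ∸ t)
            2t+[D∸t]≡2q = trans 2q≡D+t (sym (trans (regroup t (D ∸ t)) (trans (cong (t +_) (m+[n∸m]≡n t≤D)) (+-comm t D))))

    large-offset-linkage : N < D + t → Linkage i j t Si Sj
    large-offset-linkage N<D+t = routing-linkage j≡i+1+t (Tent.tent-routing t<r T p (c + D) p≤t end-eq c+D≋e)
      where
        regroup : ∀ c N x → c + (x + N) ≡ c + N + x
        regroup = solve-∀
        r<q : r < q
        r<q = *-cancelˡ-< 2 r q (subst (N <_) (sym 2q≡D+t) N<D+t)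
        p = q ∸ r
        2p+N≡D+t : 2 * p + N ≡ D + t
        2p+N≡D+t = trans (sym (*-distribˡ-+ 2 p r)) (trans (cong (2 *_) (m∸n+n≡m (<⇒≤ r<q))) 2q≡D+t)
        p≤t : p ≤ t
        p≤t = ≤-trans (m≤m+n p (p + 0)) (<⇒≤ (+-cancelʳ-< N (2 * p) t
                (subst (_< t + N) (sym 2p+N≡D+t) (subst (D + t <_) (+-comm N t) (+-monoˡ-< t D<N)))))
        end-eq : c + D + t ≡ c + N + 2 * p
        end-eq = trans (+-assoc c D t) (trans (cong (c +_) (sym 2p+N≡D+t)) (regroup c N (2 * p)))

    offset-linkage : Dec (D < t) → Dec (D + t ≤ N) → Linkage i j t Si Sj
    offset-linkage (yes D<t) _ = small-offset-linkage D<t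
    offset-linkage (no D≮t) (yes D+t≤N) = medium-offset-linkage (≮⇒≥ D≮t) D+t≤N
    offset-linkage (no _) (no D+t≰N) = large-offset-linkage (≰⇒> D+t≰N)

  terminals-linkage : ∀ {i j t Si Sj} → toℕ j ≡ toℕ i + suc t → (T : Terminals i j t Si Sj) →
    2 ∣ suc (toℕ j) + Terminals.e T → Linkage i j t Si Sj
  terminals-linkage {t = t} j≡i+1+t T 2∣1+j+e =
    let (D , D<N , c+D≋e) = offset (Terminals.c T) (Terminals.e T)
        (q , 2q≡D+t) = half (offset-even {e = Terminals.e T} {D} j≡i+1+t (Terminals.even-start T) 2∣1+j+e c+D≋e)
    in offset-linkage j≡i+1+t T {D} {q} D<N c+D≋e 2q≡D+t (D <? t) (D + t ≤? N)

  linkage : ∀ (i j : Fin r) t → toℕ j ≡ toℕ i + suc t → (Si Sj : List (Vertex r)) →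
    IsPath r Si → All (InRow i) Si → 2 * t ∸ 1 ≤ edgeLength Si →
    IsPath r Sj → All (InRow j) Sj → 2 * t ∸ 1 ≤ edgeLength Sj → Linkage i j t Si Sj
  linkage i j t j≡i+1+t Si Sj Si-path Si∈i Si-long Sj-path Sj∈j Sj-long =
    let (c , 2∣i+c , sources) = spaced-columns i (toℕ i) t Si Si-path Si∈i Si-long
        (e , 2∣1+j+e , targets) = spaced-columns j (suc (toℕ j)) t Sj Sj-path Sj∈j Sj-long
    in terminals-linkage j≡i+1+t
         (record { c = c ; e = e ; even-start = 2∣i+c ; sources = sources ; targets = targets }) 2∣1+j+e

lemma2p1 : (r : ℕ) → 3 ≤ r → (i j : Fin r) → toℕ i < toℕ j →
    (Si Sj : List (Vertex r)) →
    IsPath r Si → All (InRow i) Si → 2 * (toℕ j ∸ toℕ i ∸ 1) ∸ 1 ≤ edgeLength Si →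
    IsPath r Sj → All (InRow j) Sj → 2 * (toℕ j ∸ toℕ i ∸ 1) ∸ 1 ≤ edgeLength Sj →
    Σ (Fin (toℕ j ∸ toℕ i ∸ 1) → List (Vertex r)) λ P →
      ((a : Fin (toℕ j ∸ toℕ i ∸ 1)) → IsPath r (P a) × Links (P a) Si Sj)
      × ((a b : Fin (toℕ j ∸ toℕ i ∸ 1)) → a ≢ b → Disjoint (P a) (P b))
      × ((a : Fin (toℕ j ∸ toℕ i ∸ 1)) (k : Fin r) → toℕ i < toℕ k → toℕ k < toℕ j →
           SegmentOn k (P a))
lemma2p1 (suc r′) _ i j i<j = Grid.linkage r′ i j (toℕ j ∸ toℕ i ∸ 1) (m<n⇒n≡m+[1+n∸m∸1] i<j)
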